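{- Let $\delta=(\delta_1,\dots,\delta_r)$ be a composition of $n$, let $\omega\in\Omega_\delta$ with content $\gamma$, and let $\nu$ be the running multiplicity of $\omega$. Let $\hat\omega$ be the minimal sequence in $\Omega_\delta$, $\hat\gamma$ its content and $\hat\nu$ its running multiplicity. Then: (A) the content of $\nu$ is $\gamma'$, i.e. $\gamma'_i=|\{j:\nu_j=i\}|$; (B) $\nu$ is strictly increasing on each subinterval of $\{1,\dots,n\}$ on which $\omega$ is nonincreasing; in particular $\nu$ is strictly increasing on each $N^\delta_\ell$; (C) $\hat\nu=(1,2,\dots,\delta_1,\ 1,2,\dots,\delta_2,\ \dots,\ 1,2,\dots,\delta_r)$, i.e. $\hat\nu$ restricted to $N^\delta_\ell$ is $1,2,\dots,\delta_\ell$; (D) $\hat\gamma=\mathrm{srt}(\delta)$.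
   Context: $N^\delta_\ell:=\{\delta_1+\cdots+\delta_{\ell-1}+1,\dots,\delta_1+\cdots+\delta_\ell\}$. A lattice permutation is a finite sequence $(\omega_1,\dots,\omega_s)$ of positive integers such that for each $k\le s$ and each $a<b$, $|\{i\le k:\omega_i=a\}|\ge|\{i\le k:\omega_i=b\}|$. A sequence of length $m\le n$ is $\delta$-nonincreasing if, after appending $n-m$ entries equal to $1$, it is nonincreasing on each $N^\delta_\ell$. $\Omega_\delta$ is the set of sequences of $n$ positive integers that are lattice permutations and $\delta$-nonincreasing. The minimal sequence $\hat\omega$: $\hat\omega_1=1$ and $\hat\omega_i$ is the largest positive integer such that $(\hat\omega_1,\dots,\hat\omega_i)$ is a lattice permutation and $\delta$-nonincreasing. The content of $\omega$ is $(\gamma_1,\gamma_2,\dots)$ with $\gamma_i=|\{j:\omega_j=i\}|$. The running multiplicity of $\omega$ is $\nu=(\nu_1,\dots,\nu_n)$ with $\nu_i:=|\{j\le i:\omega_j=\omega_i\}|$. For a partition $\gamma$, its conjugate is $\gamma'_s:=|\{j:\gamma_j\ge s\}|$. $\mathrm{srt}(\delta)$ is $\delta$ sorted in nonincreasing order. -}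

module Defs where

open import Data.Nat using (ℕ; zero; suc; _+_; _∸_; _≤_; _<_; _≟_; _≤?_)
open import Data.Nat.Properties using (≤-decTotalOrder)
open import Data.List using (List; []; _∷_; _++_; [_]; length; filter; take; map; applyUpTo; reverse; foldr; concatMap)
open import Data.List.Relation.Unary.All using (All)
open import Data.List.Sort ≤-decTotalOrder using (sort)
open import Data.Nat.ListAction using (sum)
open import Data.Product using (_×_)
open import Relation.Nullary using (¬_)
open import Relation.Binary.PropositionalEquality using (_≡_)

count : ℕ → List ℕ → ℕ
count a xs = length (filter (a ≟_) xs)

oneTo : ℕ → List ℕ
oneTo d = applyUpTo suc d

maximum : List ℕ → ℕ
maximum = foldr Data.Nat._⊔_ 0

-- 1-indexed access; positions outside 1..length give 1
-- (this realises the padding by entries equal to 1 in the definition of δ-nonincreasing)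
at : List ℕ → ℕ → ℕ
at []       _             = 1
at (x ∷ xs) zero          = 1
at (x ∷ xs) (suc zero)    = x
at (x ∷ xs) (suc (suc i)) = at xs (suc i)

IsComposition : ℕ → List ℕ → Set
IsComposition n δ = All (1 ≤_) δ × sum δ ≡ n

-- i ∈ N^δ_ℓ  (ℓ ranges over 1..r, i is a 1-indexed position)
InBlock : List ℕ → ℕ → ℕ → Set
InBlock δ ℓ i = 1 ≤ ℓ × ℓ ≤ length δ × sum (take (ℓ ∸ 1) δ) < i × i ≤ sum (take ℓ δ)

Positive : List ℕ → Set
Positive w = All (1 ≤_) w

IsLattice : List ℕ → Set
IsLattice w = Positive w ×
  (∀ k a b → k ≤ length w → 1 ≤ a → a < b → count b (take k w) ≤ count a (take k w))

DeltaNonincreasing : List ℕ → List ℕ → Set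
DeltaNonincreasing δ w = length w ≤ sum δ ×
  (∀ ℓ i j → InBlock δ ℓ i → InBlock δ ℓ j → i < j → at w j ≤ at w i)

InOmega : List ℕ → List ℕ → Set
InOmega δ w = length w ≡ sum δ × IsLattice w × DeltaNonincreasing δ w

IsMinimal : List ℕ → List ℕ → Set
IsMinimal δ w = length w ≡ sum δ × (1 ≤ length w → at w 1 ≡ 1) ×
  (∀ i → 1 ≤ i → i ≤ length w →
     (IsLattice (take i w) × DeltaNonincreasing δ (take i w)) ×
     (∀ u → at w i < u →
        ¬ (IsLattice (take (i ∸ 1) w ++ [ u ]) × DeltaNonincreasing δ (take (i ∸ 1) w ++ [ u ]))))

content : List ℕ → ℕ → ℕ
content w i = count i w

contentList : List ℕ → List ℕ
contentList w = map (λ i → count i w) (oneTo (maximum w))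

conj : List ℕ → ℕ → ℕ
conj γ s = length (filter (s ≤?_) γ)

runMult : List ℕ → List ℕ
runMult w = map (λ i → count (at w i) (take i w)) (oneTo (length w))

srt : List ℕ → List ℕ
srt δ = reverse (sort δ)

-- i-th entry (1-indexed) of a partition, 0 beyond its length
part : List ℕ → ℕ → ℕ
part []       _             = 0
part (x ∷ xs) zero          = 0
part (x ∷ xs) (suc zero)    = x
part (x ∷ xs) (suc (suc i)) = part xs (suc i)

-- The running multiplicities of a lattice word grow in lockstep with its content: appending x to w
-- raises the count c of x to c + 1, which adds one to the conjugate of the content exactly at
-- s = c + 1, the new running multiplicity (A).  If ω_j ≤ ω_i with i < j, the lattice condition on
-- the prefix of length i gives ν_j > #{k ≤ i : ω_k = ω_j} ≥ #{k ≤ i : ω_k = ω_i} = ν_i (B).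
-- The minimal sequence is built greedily.  At the first position of a block nothing bounds the next
-- entry, so it is a value not used before and ν̂ = 1; inside a block the entry x is bounded by its
-- predecessor v, and if x occurred more often than v so far, some value in (x, v] could be appended
-- instead, contradicting maximality; so ν̂ grows by one (C).  Finally (A) and (C) give that the
-- conjugate of γ̂ is the conjugate of δ, and a partition is determined by its conjugate (D).

module Submission where

open import Defs
open import Data.Nat using (ℕ; zero; suc; _+_; _*_; _∸_; _≤_; _<_; _≥_; _≟_; _≤?_; _<?_; z≤n; s≤s)
open import Data.Nat.Properties
open import Data.Nat.ListAction using (sum)
open import Data.Nat.Tactic.RingSolver using (solve-∀)
open import Data.List using (List; []; _∷_; [_]; _++_; _∷ʳ_; length; map; filter; take; applyUpTo; concatMap; reverse)
open import Data.List.Properties using (filter-++; filter-accept; filter-reject; filter-none; length-++; length-map; length-applyUpTo; map-++; map-applyUpTo; map-cong-local; applyUpTo-∷ʳ; take-all; unfold-reverse)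
open import Data.List.Reverse using (Reverse; []; _∶_∶ʳ_; reverseView)
open import Data.List.Relation.Unary.All as All using (All; []; _∷_)
open import Data.List.Relation.Unary.All.Properties using (applyUpTo⁺₁; ∷ʳ⁺; ∷ʳ⁻)
open import Data.List.Relation.Unary.AllPairs using (AllPairs; []; _∷_)
import Data.List.Relation.Unary.AllPairs.Properties as AllPairs
open import Data.List.Relation.Unary.Linked.Properties using (Linked⇒AllPairs)
open import Data.List.Relation.Binary.Permutation.Propositional using (_↭_)
open import Data.List.Relation.Binary.Permutation.Propositional.Properties using (filter-↭; ↭-length; ↭-reverse)
open import Data.List.Sort ≤-decTotalOrder using (sort; sort-↭; sort-↗)
open import Data.Product using (_×_; _,_; proj₁; proj₂; ∃-syntax)
open import Data.Sum using (_⊎_; inj₁; inj₂)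
open import Data.Empty using (⊥-elim)
open import Function using (_∘_; flip)
open import Relation.Nullary using (¬_; Dec; yes; no)
open import Relation.Binary using (tri<; tri≈; tri>)
open import Relation.Binary.PropositionalEquality using (_≡_; _≢_; refl; sym; trans; cong; cong₂; subst; subst₂; module ≡-Reasoning)

count-++ : ∀ a xs ys → count a (xs ++ ys) ≡ count a xs + count a ys
count-++ a xs ys = trans (cong length (filter-++ (a ≟_) xs ys)) (length-++ (filter (a ≟_) xs))

count-∷-≡ : ∀ a xs → count a (a ∷ xs) ≡ suc (count a xs)
count-∷-≡ a xs = cong length (filter-accept (a ≟_) refl)

count-∷-≢ : ∀ {a x} xs → a ≢ x → count a (x ∷ xs) ≡ count a xs
count-∷-≢ xs a≢x = cong length (filter-reject (_ ≟_) a≢x)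

count-∷ʳ-≡ : ∀ a xs → count a (xs ∷ʳ a) ≡ suc (count a xs)
count-∷ʳ-≡ a xs = begin
  count a (xs ∷ʳ a)          ≡⟨ count-++ a xs [ a ] ⟩
  count a xs + count a [ a ]  ≡⟨ cong (count a xs +_) (count-∷-≡ a []) ⟩
  count a xs + 1              ≡⟨ +-comm (count a xs) 1 ⟩
  suc (count a xs)            ∎
  where open ≡-Reasoning

count-∷ʳ-≢ : ∀ {a x} xs → a ≢ x → count a (xs ∷ʳ x) ≡ count a xs
count-∷ʳ-≢ {a} xs a≢x = trans (count-++ a xs _) (trans (cong (count a xs +_) (count-∷-≢ [] a≢x)) (+-identityʳ _))

count-≡0 : ∀ {a} xs → All (a ≢_) xs → count a xs ≡ 0
count-≡0 {a} xs a∉xs = cong length (filter-none (a ≟_) a∉xs)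

count-≤-∷ʳ : ∀ a xs x → count a xs ≤ count a (xs ∷ʳ x)
count-≤-∷ʳ a xs x = subst (count a xs ≤_) (sym (count-++ a xs [ x ])) (m≤m+n _ _)

xs≤maximum : ∀ xs → All (_≤ maximum xs) xs
xs≤maximum []       = []
xs≤maximum (x ∷ xs) = m≤m⊔n x (maximum xs) ∷ All.map (λ y≤ → ≤-trans y≤ (m≤n⊔m x (maximum xs))) (xs≤maximum xs)

count-beyond-maximum : ∀ {x} xs → maximum xs < x → count x xs ≡ 0
count-beyond-maximum xs max<x =
  count-≡0 xs (All.map (λ y≤max x≡y → <-irrefl refl (<-≤-trans max<x (subst (_≤ _) (sym x≡y) y≤max))) (xs≤maximum xs))

count-maximum : ∀ xs → 1 ≤ maximum xs → 1 ≤ count (maximum xs) xs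
count-maximum (x ∷ xs) 1≤max with ≤-total x (maximum xs)
... | inj₁ x≤m rewrite m≤n⇒m⊔n≡n x≤m =
  ≤-trans (count-maximum xs 1≤max) (subst (count (maximum xs) xs ≤_) (sym (count-++ (maximum xs) [ x ] xs)) (m≤n+m _ _))
... | inj₂ m≤x rewrite m≥n⇒m⊔n≡m m≤x = subst (1 ≤_) (sym (count-∷-≡ x xs)) (s≤s z≤n)

oneTo-∷ʳ : ∀ n → oneTo (suc n) ≡ oneTo n ∷ʳ suc n
oneTo-∷ʳ n = sym (applyUpTo-∷ʳ suc n)

oneTo-bounded : ∀ n → All (λ i → 1 ≤ i × i ≤ n) (oneTo n)
oneTo-bounded n = applyUpTo⁺₁ suc n (λ i<n → s≤s z≤n , i<n)

count-oneTo-out : ∀ {x} n → n < x → count x (oneTo n) ≡ 0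
count-oneTo-out n n<x =
  count-≡0 (oneTo n) (All.map (λ (_ , i≤n) x≡i → <-irrefl refl (<-≤-trans n<x (subst (_≤ n) (sym x≡i) i≤n))) (oneTo-bounded n))

count-oneTo : ∀ {x} n → 1 ≤ x → x ≤ n → count x (oneTo n) ≡ 1
count-oneTo zero (s≤s _) ()
count-oneTo {x} (suc n) 1≤x x≤1+n = trans (cong (count x) (oneTo-∷ʳ n)) (step (x ≟ suc n))
  where
  step : Dec (x ≡ suc n) → count x (oneTo n ∷ʳ suc n) ≡ 1
  step (yes refl)    = trans (count-∷ʳ-≡ x (oneTo n)) (cong suc (count-oneTo-out n ≤-refl))
  step (no x≢1+n) = trans (count-∷ʳ-≢ (oneTo n) x≢1+n) (count-oneTo n 1≤x (≤-pred (≤∧≢⇒< x≤1+n x≢1+n)))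

length-∷ʳ : ∀ (xs : List ℕ) x → length (xs ∷ʳ x) ≡ suc (length xs)
length-∷ʳ []       x = refl
length-∷ʳ (_ ∷ xs) x = cong suc (length-∷ʳ xs x)

length-take-≤ : ∀ {k} (w : List ℕ) → k ≤ length w → length (take k w) ≡ k
length-take-≤ {zero}  w       _         = refl
length-take-≤ {suc k} (_ ∷ w) (s≤s k≤) = cong suc (length-take-≤ w k≤)

take-++ˡ : ∀ {k} (xs ys : List ℕ) → k ≤ length xs → take k (xs ++ ys) ≡ take k xs
take-++ˡ {zero}  xs       ys _         = refl
take-++ˡ {suc k} (x ∷ xs) ys (s≤s k≤) = cong (x ∷_) (take-++ˡ xs ys k≤)

take-length-∷ʳ : ∀ (xs : List ℕ) x → take (suc (length xs)) (xs ∷ʳ x) ≡ xs ∷ʳ x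
take-length-∷ʳ xs x = take-all _ (xs ∷ʳ x) (≤-reflexive (length-∷ʳ xs x))

at-positive : ∀ {w} i → Positive w → 1 ≤ at w i
at-positive {[]}    i             _          = ≤-refl
at-positive {_ ∷ _} zero          _          = ≤-refl
at-positive {_ ∷ _} (suc zero)    (p ∷ _)    = p
at-positive {_ ∷ _} (suc (suc i)) (_ ∷ pos) = at-positive (suc i) pos

at-beyond : ∀ w {q} → length w < q → at w q ≡ 1
at-beyond []      _                     = refl
at-beyond (_ ∷ w) {suc (suc q)} (s≤s q>) = at-beyond w q>

at-++ˡ : ∀ xs ys {i} → 1 ≤ i → i ≤ length xs → at (xs ++ ys) i ≡ at xs i
at-++ˡ (x ∷ xs) ys {suc zero}    _ _        = refl
at-++ˡ (x ∷ xs) ys {suc (suc i)} _ (s≤s i≤) = at-++ˡ xs ys (s≤s z≤n) i≤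

at-++ʳ : ∀ xs ys j → at (xs ++ ys) (suc (length xs + j)) ≡ at ys (suc j)
at-++ʳ []       ys j = refl
at-++ʳ (x ∷ xs) ys j = at-++ʳ xs ys j

at-∷ʳ-last : ∀ xs y → at (xs ∷ʳ y) (suc (length xs)) ≡ y
at-∷ʳ-last []       y = refl
at-∷ʳ-last (x ∷ xs) y = at-∷ʳ-last xs y

at-take : ∀ w {k i} → 1 ≤ i → i ≤ k → at (take k w) i ≡ at w i
at-take _       {zero}  (s≤s _) ()
at-take []      {suc k} _ _                          = refl
at-take (x ∷ w) {suc k} {suc zero}    _ _           = refl
at-take (x ∷ w) {suc k} {suc (suc i)} _ (s≤s i≤k) = at-take w (s≤s z≤n) i≤k

take-suc-∷ʳ : ∀ k w → suc k ≤ length w → take (suc k) w ≡ take k w ∷ʳ at w (suc k)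
take-suc-∷ʳ zero    (x ∷ w) _        = refl
take-suc-∷ʳ (suc k) (x ∷ w) (s≤s k<) = cong (x ∷_) (take-suc-∷ʳ k w k<)

count-take-mono : ∀ a w {k m} → k ≤ m → count a (take k w) ≤ count a (take m w)
count-take-mono a w       {zero}  _         = z≤n
count-take-mono a []      {suc k} {suc m} _ = z≤n
count-take-mono a (x ∷ w) {suc k} {suc m} (s≤s k≤m) with a ≟ x
... | yes refl = subst₂ _≤_ (sym (count-∷-≡ a (take k w))) (sym (count-∷-≡ a (take m w))) (s≤s (count-take-mono a w k≤m))
... | no a≢x = subst₂ _≤_ (sym (count-∷-≢ (take k w) a≢x)) (sym (count-∷-≢ (take m w) a≢x)) (count-take-mono a w k≤m)

at-applyUpTo : ∀ (f : ℕ → ℕ) n {j} → j < n → at (applyUpTo f n) (suc j) ≡ f j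
at-applyUpTo f (suc n) {zero}  _        = refl
at-applyUpTo f (suc n) {suc j} (s≤s j<) = at-applyUpTo (f ∘ suc) n j<

at-map-oneTo : ∀ (g : ℕ → ℕ) n {i} → 1 ≤ i → i ≤ n → at (map g (oneTo n)) i ≡ g i
at-map-oneTo g n {suc j} _ j<n = trans (cong (λ l → at l (suc j)) (map-applyUpTo suc g n)) (at-applyUpTo (g ∘ suc) n j<n)

length-map-oneTo : ∀ (g : ℕ → ℕ) n → length (map g (oneTo n)) ≡ n
length-map-oneTo g n = trans (length-map g (oneTo n)) (length-applyUpTo suc n)

≡-by-at : ∀ (xs ys : List ℕ) → length xs ≡ length ys →
  (∀ i → 1 ≤ i → i ≤ length xs → at xs i ≡ at ys i) → xs ≡ ys
≡-by-at []       []       _   _    = refl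
≡-by-at (x ∷ xs) (y ∷ ys) len ats =
  cong₂ _∷_ (ats 1 ≤-refl (s≤s z≤n))
    (≡-by-at xs ys (suc-injective len) (λ { (suc i) _ i≤ → ats (suc (suc i)) (s≤s z≤n) (s≤s i≤) }))

-- Running multiplicities of lattice words

length-runMult : ∀ w → length (runMult w) ≡ length w
length-runMult w = length-map-oneTo _ (length w)

at-runMult : ∀ w {i} → 1 ≤ i → i ≤ length w → at (runMult w) i ≡ count (at w i) (take i w)
at-runMult w = at-map-oneTo (λ i → count (at w i) (take i w)) (length w)

runMult-∷ʳ : ∀ xs x → runMult (xs ∷ʳ x) ≡ runMult xs ∷ʳ suc (count x xs)
runMult-∷ʳ xs x = begin
  map ν (oneTo (length (xs ∷ʳ x)))         ≡⟨ cong (map ν ∘ oneTo) (length-∷ʳ xs x) ⟩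
  map ν (oneTo (suc n))                    ≡⟨ cong (map ν) (oneTo-∷ʳ n) ⟩
  map ν (oneTo n ∷ʳ suc n)                 ≡⟨ map-++ ν (oneTo n) [ suc n ] ⟩
  map ν (oneTo n) ∷ʳ ν (suc n)             ≡⟨ cong₂ _∷ʳ_ (map-cong-local (All.map ν-prefix (oneTo-bounded n))) ν-last ⟩
  runMult xs ∷ʳ suc (count x xs)           ∎
  where
  open ≡-Reasoning
  n = length xs
  ν : ℕ → ℕ
  ν i = count (at (xs ∷ʳ x) i) (take i (xs ∷ʳ x))
  ν-prefix : ∀ {i} → 1 ≤ i × i ≤ n → ν i ≡ count (at xs i) (take i xs)
  ν-prefix (1≤i , i≤n) = cong₂ count (at-++ˡ xs [ x ] 1≤i i≤n) (take-++ˡ xs [ x ] i≤n)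
  ν-last : ν (suc n) ≡ suc (count x xs)
  ν-last = trans (cong₂ count (at-∷ʳ-last xs x) (take-length-∷ʳ xs x)) (count-∷ʳ-≡ x xs)

lattice-count-antitone : ∀ {w k a b} → IsLattice w → k ≤ length w → 1 ≤ a → a ≤ b →
  count b (take k w) ≤ count a (take k w)
lattice-count-antitone {k = k} {a} lat k≤ 1≤a a≤b with m≤n⇒m<n∨m≡n a≤b
... | inj₁ a<b  = proj₂ lat k a _ k≤ 1≤a a<b
... | inj₂ refl = ≤-refl

count-antitone : ∀ {w a b} → IsLattice w → 1 ≤ a → a ≤ b → count b w ≤ count a w
count-antitone {w} {a} {b} lat 1≤a a≤b =
  subst (λ v → count b v ≤ count a v) (take-all (length w) w ≤-refl) (lattice-count-antitone lat ≤-refl 1≤a a≤b)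

runMult-increasing : ∀ {ω i j} → IsLattice ω → 1 ≤ i → i < j → j ≤ length ω → at ω j ≤ at ω i →
  at (runMult ω) i < at (runMult ω) j
runMult-increasing {ω} {i} {suc j} lat 1≤i (s≤s i≤j) j<len ωj≤ωi = begin-strict
  at (runMult ω) i                         ≡⟨ at-runMult ω 1≤i i≤len ⟩
  count (at ω i) (take i ω)                ≤⟨ lattice-count-antitone lat i≤len (at-positive (suc j) (proj₁ lat)) ωj≤ωi ⟩
  count x (take i ω)                       ≤⟨ count-take-mono x ω i≤j ⟩
  count x (take j ω)                       <⟨ n<1+n _ ⟩
  suc (count x (take j ω))                 ≡⟨ sym (count-∷ʳ-≡ x (take j ω)) ⟩
  count x (take j ω ∷ʳ x)                  ≡⟨ cong (count x) (sym (take-suc-∷ʳ j ω j<len)) ⟩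
  count x (take (suc j) ω)                 ≡⟨ sym (at-runMult ω (s≤s z≤n) j<len) ⟩
  at (runMult ω) (suc j)                   ∎
  where
  open ≤-Reasoning
  x = at ω (suc j)
  i≤len = ≤-trans (≤-trans i≤j (n≤1+n j)) j<len

-- Conjugates of contents (A)

counts : List ℕ → List ℕ → List ℕ
counts L w = map (λ a → count a w) L

conj-∷ : ∀ x xs s → conj (x ∷ xs) s ≡ conj [ x ] s + conj xs s
conj-∷ x xs s = trans (cong length (filter-++ (s ≤?_) [ x ] xs)) (length-++ (filter (s ≤?_) [ x ]))

conj-[-]-≤ : ∀ {s x} → s ≤ x → conj [ x ] s ≡ 1
conj-[-]-≤ s≤x = cong length (filter-accept (_ ≤?_) s≤x)

conj-[-]-> : ∀ {s x} → x < s → conj [ x ] s ≡ 0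
conj-[-]-> x<s = cong length (filter-reject (_ ≤?_) (<⇒≱ x<s))

conj-[suc] : ∀ c s → conj [ suc c ] s ≡ count s [ suc c ] + conj [ c ] s
conj-[suc] c s with s ≤? c | s ≟ suc c
... | yes s≤c | _ = begin
  conj [ suc c ] s             ≡⟨ conj-[-]-≤ (m≤n⇒m≤1+n s≤c) ⟩
  1                            ≡⟨ cong₂ _+_ (sym (count-∷-≢ [] (<⇒≢ (s≤s s≤c)))) (sym (conj-[-]-≤ s≤c)) ⟩
  count s [ suc c ] + conj [ c ] s ∎
  where open ≡-Reasoning
... | no s≰c | yes refl = trans (conj-[-]-≤ {s} ≤-refl) (sym (cong₂ _+_ (count-∷-≡ s []) (conj-[-]-> {s} {c} ≤-refl)))
... | no s≰c | no s≢1+c = trans (conj-[-]-> (≤∧≢⇒< (≰⇒> s≰c) (s≢1+c ∘ sym)))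
                             (sym (cong₂ _+_ (count-∷-≢ [] s≢1+c) (conj-[-]-> (≰⇒> s≰c))))

-- Appending x raises the count of x from c to c + 1, which changes the conjugate only at s = c + 1.
conj-counts-∷ʳ : ∀ L w x s →
  conj (counts L (w ∷ʳ x)) s ≡ count s [ suc (count x w) ] * count x L + conj (counts L w) s
conj-counts-∷ʳ []      w x s = sym (cong (_+ 0) (*-zeroʳ (count s [ suc (count x w) ])))
conj-counts-∷ʳ (a ∷ L) w x s with a ≟ x
... | yes refl = begin
  conj (count a (w ∷ʳ a) ∷ counts L (w ∷ʳ a)) s           ≡⟨ conj-∷ _ _ s ⟩
  conj [ count a (w ∷ʳ a) ] s + conj (counts L (w ∷ʳ a)) s ≡⟨ cong₂ _+_ (cong (λ m → conj [ m ] s) (count-∷ʳ-≡ a w)) (conj-counts-∷ʳ L w a s) ⟩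
  conj [ suc c ] s + (e * count a L + rest)                ≡⟨ cong (_+ (e * count a L + rest)) (conj-[suc] c s) ⟩
  (e + conj [ c ] s) + (e * count a L + rest)              ≡⟨ regroup e (conj [ c ] s) (count a L) rest ⟩
  e * suc (count a L) + (conj [ c ] s + rest)              ≡⟨ cong₂ _+_ (cong (e *_) (sym (count-∷-≡ a L))) (sym (conj-∷ c _ s)) ⟩
  e * count a (a ∷ L) + conj (counts (a ∷ L) w) s          ∎
  where
  open ≡-Reasoning
  c = count a w
  e = count s [ suc c ]
  rest = conj (counts L w) s
  regroup : ∀ e p k r → (e + p) + (e * k + r) ≡ e * suc k + (p + r)
  regroup = solve-∀
... | no a≢x = begin
  conj (count a (w ∷ʳ x) ∷ counts L (w ∷ʳ x)) s           ≡⟨ conj-∷ _ _ s ⟩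
  conj [ count a (w ∷ʳ x) ] s + conj (counts L (w ∷ʳ x)) s ≡⟨ cong₂ _+_ (cong (λ m → conj [ m ] s) (count-∷ʳ-≢ w a≢x)) (conj-counts-∷ʳ L w x s) ⟩
  conj [ count a w ] s + (e * count x L + rest)            ≡⟨ +-comm-middle (conj [ count a w ] s) (e * count x L) rest ⟩
  e * count x L + (conj [ count a w ] s + rest)            ≡⟨ cong₂ _+_ (cong (e *_) (sym (count-∷-≢ L (a≢x ∘ sym)))) (sym (conj-∷ _ _ s)) ⟩
  e * count x (a ∷ L) + conj (counts (a ∷ L) w) s          ∎
  where
  open ≡-Reasoning
  e = count s [ suc (count x w) ]
  rest = conj (counts L w) s
  +-comm-middle : ∀ p q r → p + (q + r) ≡ q + (p + r)
  +-comm-middle = solve-∀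

conj-counts-[] : ∀ L s → 1 ≤ s → conj (counts L []) s ≡ 0
conj-counts-[] []      s _   = refl
conj-counts-[] (a ∷ L) s 1≤s = trans (conj-∷ 0 (counts L []) s) (cong₂ _+_ (conj-[-]-> 1≤s) (conj-counts-[] L s 1≤s))

conj-counts≡count-runMult : ∀ L {w} → All (λ x → count x L ≡ 1) w → ∀ s → 1 ≤ s →
  conj (counts L w) s ≡ count s (runMult w)
conj-counts≡count-runMult L {w} once s 1≤s = go (reverseView w) once
  where
  go : ∀ {w} → Reverse w → All (λ x → count x L ≡ 1) w → conj (counts L w) s ≡ count s (runMult w)
  go []              _    = conj-counts-[] L s 1≤s
  go (xs ∶ rs ∶ʳ x) once with ∷ʳ⁻ once
  ... | once-xs , once-x = begin
    conj (counts L (xs ∷ʳ x)) s                       ≡⟨ conj-counts-∷ʳ L xs x s ⟩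
    e * count x L + conj (counts L xs) s              ≡⟨ cong₂ _+_ (trans (cong (e *_) once-x) (*-identityʳ e)) (go rs once-xs) ⟩
    e + count s (runMult xs)                          ≡⟨ +-comm e _ ⟩
    count s (runMult xs) + e                          ≡⟨ sym (count-++ s (runMult xs) _) ⟩
    count s (runMult xs ∷ʳ suc (count x xs))          ≡⟨ cong (count s) (sym (runMult-∷ʳ xs x)) ⟩
    count s (runMult (xs ∷ʳ x))                       ∎
    where
    open ≡-Reasoning
    e = count s [ suc (count x xs) ]

conj-content≡count-runMult : ∀ {ω} → Positive ω → ∀ s → 1 ≤ s → conj (contentList ω) s ≡ count s (runMult ω)
conj-content≡count-runMult {ω} pos =
  conj-counts≡count-runMult (oneTo (maximum ω))
    (All.zipWith (λ (1≤x , x≤max) → count-oneTo (maximum ω) 1≤x x≤max) (pos , xs≤maximum ω))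

-- Partitions are determined by their conjugates

NonIncreasing : List ℕ → Set
NonIncreasing = AllPairs _≥_

All-reverse : ∀ {P : ℕ → Set} {xs} → All P xs → All P (reverse xs)
All-reverse {P} {[]}     []         = []
All-reverse {P} {x ∷ xs} (px ∷ pxs) = subst (All P) (sym (unfold-reverse x xs)) (∷ʳ⁺ (All-reverse pxs) px)

AllPairs-reverse : ∀ {R : ℕ → ℕ → Set} {xs} → AllPairs R xs → AllPairs (flip R) (reverse xs)
AllPairs-reverse {R} {[]}     []          = []
AllPairs-reverse {R} {x ∷ xs} (Rx ∷ Rxs) = subst (AllPairs (flip R)) (sym (unfold-reverse x xs))
  (AllPairs.++⁺ (AllPairs-reverse Rxs) ([] ∷ []) (All.map (_∷ []) (All-reverse Rx)))

srt-nonIncreasing : ∀ δ → NonIncreasing (srt δ)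
srt-nonIncreasing δ = AllPairs-reverse (Linked⇒AllPairs ≤-trans (sort-↗ δ))

conj-↭ : ∀ {xs ys} → xs ↭ ys → ∀ s → conj xs s ≡ conj ys s
conj-↭ xs↭ys s = ↭-length (filter-↭ (s ≤?_) xs↭ys)

conj-srt : ∀ δ s → conj (srt δ) s ≡ conj δ s
conj-srt δ s = trans (conj-↭ (↭-reverse (sort δ)) s) (conj-↭ (sort-↭ δ) s)

conj-all-< : ∀ {s} xs → All (_< s) xs → conj xs s ≡ 0
conj-all-< {s} xs xs<s = cong length (filter-none (s ≤?_) (All.map <⇒≱ xs<s))

part-≤ : ∀ {x} L → All (_≤ x) L → ∀ i → part L i ≤ x
part-≤ []      _          i             = z≤n
part-≤ (y ∷ L) _          zero          = z≤n
part-≤ (y ∷ L) (y≤x ∷ _)  (suc zero)    = y≤x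
part-≤ (y ∷ L) (_ ∷ L≤x) (suc (suc i)) = part-≤ L L≤x (suc i)

-- The cell (v, s) lies in the Young diagram of L iff (s, v) lies in that of its conjugate.
≤-part⇒≤-conj : ∀ {L} → NonIncreasing L → ∀ {v s} → 1 ≤ v → 1 ≤ s → s ≤ part L v → v ≤ conj L s
≤-part⇒≤-conj []                       _       (s≤s _) ()
≤-part⇒≤-conj {x ∷ L} (x≥L ∷ dec) {suc v} {s} _ 1≤s s≤part = subst (suc v ≤_) (sym (conj-∷ x L s)) (helper v s≤part)
  where
  helper : ∀ v → s ≤ part (x ∷ L) (suc v) → suc v ≤ conj [ x ] s + conj L s
  helper zero          s≤x = subst (λ m → 1 ≤ m + conj L s) (sym (conj-[-]-≤ s≤x)) (s≤s z≤n)
  helper (suc v) s≤part = subst (λ m → suc (suc v) ≤ m + conj L s) (sym (conj-[-]-≤ (≤-trans s≤part (part-≤ L x≥L (suc v)))))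
                            (s≤s (≤-part⇒≤-conj dec (s≤s z≤n) 1≤s s≤part))

≤-conj⇒≤-part : ∀ {L} → NonIncreasing L → ∀ {v s} → 1 ≤ v → v ≤ conj L s → s ≤ part L v
≤-conj⇒≤-part [] {suc v} _ ()
≤-conj⇒≤-part {x ∷ L} (x≥L ∷ dec) {suc v} {s} _ v≤conj with s ≤? x
... | no s≰x with () ← subst (suc v ≤_) (conj-all-< (x ∷ L) (≰⇒> s≰x ∷ All.map (λ y≤x → ≤-<-trans y≤x (≰⇒> s≰x)) x≥L)) v≤conj
≤-conj⇒≤-part {x ∷ L} (x≥L ∷ dec) {suc zero}    _ _       | yes s≤x = s≤x
≤-conj⇒≤-part {x ∷ L} (x≥L ∷ dec) {suc (suc v)} {s} _ v≤conj | yes s≤x =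
  ≤-conj⇒≤-part dec (s≤s z≤n) (≤-pred (subst (suc (suc v) ≤_) (trans (conj-∷ x L s) (cong (_+ conj L s) (conj-[-]-≤ s≤x))) v≤conj))

part-≤-part : ∀ {L L'} → NonIncreasing L → NonIncreasing L' → (∀ s → 1 ≤ s → conj L s ≡ conj L' s) →
  ∀ {v} → 1 ≤ v → part L v ≤ part L' v
part-≤-part {L} {L'} dec dec' same {v} 1≤v with part L v in eq
... | zero  = z≤n
... | suc p = ≤-conj⇒≤-part dec' 1≤v
               (subst (v ≤_) (same (suc p) (s≤s z≤n)) (≤-part⇒≤-conj dec 1≤v (s≤s z≤n) (≤-reflexive (sym eq))))

part-unique : ∀ {L L'} → NonIncreasing L → NonIncreasing L' → (∀ s → 1 ≤ s → conj L s ≡ conj L' s) →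
  ∀ v → 1 ≤ v → part L v ≡ part L' v
part-unique dec dec' same v 1≤v =
  ≤-antisym (part-≤-part dec dec' same 1≤v) (part-≤-part dec' dec (λ s 1≤s → sym (same s 1≤s)) 1≤v)

count-concat-oneTo : ∀ δ {s} → 1 ≤ s → count s (concatMap oneTo δ) ≡ conj δ s
count-concat-oneTo []      _   = refl
count-concat-oneTo (d ∷ δ) {s} 1≤s = begin
  count s (oneTo d ++ concatMap oneTo δ)       ≡⟨ count-++ s (oneTo d) _ ⟩
  count s (oneTo d) + count s (concatMap oneTo δ) ≡⟨ cong₂ _+_ (head (s ≤? d)) (count-concat-oneTo δ 1≤s) ⟩
  conj [ d ] s + conj δ s                        ≡⟨ sym (conj-∷ d δ s) ⟩
  conj (d ∷ δ) s                                 ∎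
  where
  open ≡-Reasoning
  head : Dec (s ≤ d) → count s (oneTo d) ≡ conj [ d ] s
  head (yes s≤d) = trans (count-oneTo d 1≤s s≤d) (sym (conj-[-]-≤ s≤d))
  head (no s≰d)  = trans (count-oneTo-out d (≰⇒> s≰d)) (sym (conj-[-]-> (≰⇒> s≰d)))

contentList-nonIncreasing : ∀ {w} → IsLattice w → NonIncreasing (contentList w)
contentList-nonIncreasing {w} lat = subst NonIncreasing (sym (map-applyUpTo suc (λ i → count i w) (maximum w)))
  (AllPairs.applyUpTo⁺₁ (λ i → count (suc i) w) (maximum w) (λ i<j _ → count-antitone lat (s≤s z≤n) (s≤s (<⇒≤ i<j))))

part≡at : ∀ L {i} → 1 ≤ i → i ≤ length L → part L i ≡ at L i
part≡at (x ∷ L) {suc zero}    _ _        = refl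
part≡at (x ∷ L) {suc (suc i)} _ (s≤s i≤) = part≡at L (s≤s z≤n) i≤

part-beyond : ∀ L {i} → length L < i → part L i ≡ 0
part-beyond []      _                      = refl
part-beyond (x ∷ L) {suc (suc i)} (s≤s i>) = part-beyond L i>

content≡part-contentList : ∀ w {v} → 1 ≤ v → content w v ≡ part (contentList w) v
content≡part-contentList w {v} 1≤v with v ≤? maximum w
... | yes v≤max = sym (trans (part≡at (contentList w) 1≤v (subst (v ≤_) (sym (length-map-oneTo _ (maximum w))) v≤max))
                             (at-map-oneTo (λ i → count i w) (maximum w) 1≤v v≤max))
... | no v≰max = trans (count-beyond-maximum w (≰⇒> v≰max))
                       (sym (part-beyond (contentList w) (subst (_< v) (sym (length-map-oneTo _ (maximum w))) (≰⇒> v≰max))))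

sum-take-mono : ∀ δ {a b} → a ≤ b → sum (take a δ) ≤ sum (take b δ)
sum-take-mono δ       {zero}          _         = z≤n
sum-take-mono []      {suc a} {suc b} _         = z≤n
sum-take-mono (d ∷ δ) {suc a} {suc b} (s≤s a≤b) = +-monoʳ-≤ d (sum-take-mono δ a≤b)

sum-take-≤ : ∀ δ a → sum (take a δ) ≤ sum δ
sum-take-≤ δ       zero    = z≤n
sum-take-≤ []      (suc a) = z≤n
sum-take-≤ (d ∷ δ) (suc a) = +-monoʳ-≤ d (sum-take-≤ δ a)

InBlock-positive : ∀ {δ ℓ i} → InBlock δ ℓ i → 1 ≤ i
InBlock-positive (_ , _ , start<i , _) = ≤-trans (s≤s z≤n) start<i

InBlock-≤-sum : ∀ {δ ℓ i} → InBlock δ ℓ i → i ≤ sum δ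
InBlock-≤-sum {δ} {ℓ} (_ , _ , _ , i≤end) = ≤-trans i≤end (sum-take-≤ δ ℓ)

InBlock-between : ∀ {δ ℓ p q m} → InBlock δ ℓ p → InBlock δ ℓ q → p ≤ m → m ≤ q → InBlock δ ℓ m
InBlock-between (1≤ℓ , ℓ≤r , start<p , _) (_ , _ , _ , q≤end) p≤m m≤q =
  1≤ℓ , ℓ≤r , <-≤-trans start<p p≤m , ≤-trans m≤q q≤end

<⇒≤∸1 : ∀ {x y} → x < y → x ≤ y ∸ 1
<⇒≤∸1 {y = suc y} (s≤s x≤y) = x≤y

InBlock-unique : ∀ {δ ℓ ℓ' i} → InBlock δ ℓ i → InBlock δ ℓ' i → ℓ ≡ ℓ'
InBlock-unique {δ} {ℓ} {ℓ'} (_ , _ , start<i , i≤end) (_ , _ , start'<i , i≤end') with <-cmp ℓ ℓ'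
... | tri≈ _ ℓ≡ℓ' _ = ℓ≡ℓ'
... | tri< ℓ<ℓ' _ _ = ⊥-elim (<-irrefl refl (≤-<-trans (≤-trans i≤end (sum-take-mono δ (<⇒≤∸1 ℓ<ℓ'))) start'<i))
... | tri> _ _ ℓ'<ℓ = ⊥-elim (<-irrefl refl (≤-<-trans (≤-trans i≤end' (sum-take-mono δ (<⇒≤∸1 ℓ'<ℓ))) start<i))

InBlock-∷⁺ : ∀ {d δ m j} → InBlock δ (suc m) j → InBlock (d ∷ δ) (suc (suc m)) (d + j)
InBlock-∷⁺ {d} (_ , ℓ≤r , start<j , j≤end) = s≤s z≤n , s≤s ℓ≤r , +-monoʳ-< d start<j , +-monoʳ-≤ d j≤end

InBlock-∷⁻ : ∀ {d δ m i} → InBlock (d ∷ δ) (suc (suc m)) i → ∃[ j ] i ≡ d + j × InBlock δ (suc m) j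
InBlock-∷⁻ {d} {δ} {m} {i} (_ , s≤s ℓ≤r , start<i , i≤end) =
  i ∸ d , i≡d+[i∸d] , s≤s z≤n , ℓ≤r ,
  +-cancelˡ-< d _ _ (subst (d + sum (take m δ) <_) i≡d+[i∸d] start<i) ,
  +-cancelˡ-≤ d _ _ (subst (_≤ d + sum (take (suc m) δ)) i≡d+[i∸d] i≤end)
  where i≡d+[i∸d] = sym (m+[n∸m]≡n (≤-trans (m≤m+n d _) (<⇒≤ start<i)))

InBlock-exists : ∀ δ {i} → 1 ≤ i → i ≤ sum δ → ∃[ ℓ ] InBlock δ ℓ i
InBlock-exists [] (s≤s _) ()
InBlock-exists (d ∷ δ) {i} 1≤i i≤sum with i ≤? d
... | yes i≤d = 1 , s≤s z≤n , s≤s z≤n , 1≤i , subst (i ≤_) (sym (+-identityʳ d)) i≤d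
... | no i≰d = subst (λ i → ∃[ ℓ ] InBlock (d ∷ δ) ℓ i) d+[i∸d]≡i (shift (InBlock-exists δ (m<n⇒0<n∸m d<i) i∸d≤sum))
  where
  d<i = ≰⇒> i≰d
  d+[i∸d]≡i = m+[n∸m]≡n (<⇒≤ d<i)
  i∸d≤sum : i ∸ d ≤ sum δ
  i∸d≤sum = +-cancelˡ-≤ d _ _ (subst (_≤ d + sum δ) (sym d+[i∸d]≡i) i≤sum)
  shift : ∃[ ℓ ] InBlock δ ℓ (i ∸ d) → ∃[ ℓ ] InBlock (d ∷ δ) ℓ (d + (i ∸ d))
  shift (suc m , i∸d∈m) = suc (suc m) , InBlock-∷⁺ i∸d∈m

length-concat-oneTo : ∀ δ → length (concatMap oneTo δ) ≡ sum δ
length-concat-oneTo []      = refl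
length-concat-oneTo (d ∷ δ) = trans (length-++ (oneTo d)) (cong₂ _+_ (length-applyUpTo suc d) (length-concat-oneTo δ))

at-concat-oneTo : ∀ δ {ℓ i} → InBlock δ ℓ i → at (concatMap oneTo δ) i ≡ i ∸ sum (take (ℓ ∸ 1) δ)
at-concat-oneTo (d ∷ δ) {suc zero} {suc j} (_ , _ , _ , i≤end) = begin
  at (oneTo d ++ concatMap oneTo δ) (suc j) ≡⟨ at-++ˡ (oneTo d) _ (s≤s z≤n) (subst (suc j ≤_) (sym (length-applyUpTo suc d)) j<d) ⟩
  at (oneTo d) (suc j)                       ≡⟨ at-applyUpTo suc d j<d ⟩
  suc j                                      ∎
  where
  open ≡-Reasoning
  j<d = subst (suc j ≤_) (+-identityʳ d) i≤end
at-concat-oneTo (d ∷ δ) {suc (suc m)} i∈ℓ with InBlock-∷⁻ i∈ℓ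
... | suc j , refl , j∈ℓ = begin
  at (oneTo d ++ concatMap oneTo δ) (d + suc j)        ≡⟨ cong (at (oneTo d ++ concatMap oneTo δ)) (+-suc d j) ⟩
  at (oneTo d ++ concatMap oneTo δ) (suc (d + j))      ≡⟨ cong (λ n → at (oneTo d ++ concatMap oneTo δ) (suc (n + j))) (sym (length-applyUpTo suc d)) ⟩
  at (oneTo d ++ concatMap oneTo δ) (suc (length (oneTo d) + j)) ≡⟨ at-++ʳ (oneTo d) _ j ⟩
  at (concatMap oneTo δ) (suc j)                       ≡⟨ at-concat-oneTo δ j∈ℓ ⟩
  suc j ∸ sum (take m δ)                               ≡⟨ sym ([m+n]∸[m+o]≡n∸o d (suc j) (sum (take m δ))) ⟩
  d + suc j ∸ (d + sum (take m δ))                     ∎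
  where open ≡-Reasoning
... | zero , _ , (_ , _ , () , _)

-- The minimal sequence (C, D)

Admissible : List ℕ → List ℕ → Set
Admissible δ P = IsLattice P × DeltaNonincreasing δ P

Addable : List ℕ → ℕ → Set
Addable P u = ∀ a → 1 ≤ a → a < u → count u P < count a P

admissible-[] : ∀ δ → Admissible δ []
admissible-[] δ = ([] , λ { zero _ _ _ _ _ → z≤n }) , z≤n , λ _ _ _ _ _ _ → ≤-refl

lattice-∷ʳ : ∀ {P u} → IsLattice P → 1 ≤ u → Addable P u → IsLattice (P ∷ʳ u)
lattice-∷ʳ {P} {u} lat 1≤u addable = ∷ʳ⁺ (proj₁ lat) 1≤u , prefix
  where
  prefix : ∀ k a b → k ≤ length (P ∷ʳ u) → 1 ≤ a → a < b → count b (take k (P ∷ʳ u)) ≤ count a (take k (P ∷ʳ u))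
  prefix k a b k≤ 1≤a a<b with m≤n⇒m<n∨m≡n (subst (k ≤_) (length-∷ʳ P u) k≤)
  ... | inj₁ (s≤s k≤len) rewrite take-++ˡ P [ u ] k≤len = proj₂ lat k a b k≤len 1≤a a<b
  ... | inj₂ refl rewrite take-length-∷ʳ P u with b ≟ u
  ...   | yes refl rewrite count-∷ʳ-≡ b P = ≤-trans (addable a 1≤a a<b) (count-≤-∷ʳ a P b)
  ...   | no b≢u rewrite count-∷ʳ-≢ P b≢u = ≤-trans (count-antitone lat 1≤a (<⇒≤ a<b)) (count-≤-∷ʳ a P u)

deltaNonincreasing-∷ʳ : ∀ {δ P u} → DeltaNonincreasing δ P → Positive P → length P < sum δ → 1 ≤ u →
  (∀ ℓ → InBlock δ ℓ (length P) → InBlock δ ℓ (suc (length P)) → u ≤ at P (length P)) →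
  DeltaNonincreasing δ (P ∷ʳ u)
deltaNonincreasing-∷ʳ {δ} {P} {u} (_ , dec) pos len<sum 1≤u u≤last =
  subst (_≤ sum δ) (sym (length-∷ʳ P u)) len<sum , dec′
  where
  dec′ : ∀ ℓ p q → InBlock δ ℓ p → InBlock δ ℓ q → p < q → at (P ∷ʳ u) q ≤ at (P ∷ʳ u) p
  dec′ ℓ p q p∈ℓ q∈ℓ p<q with <-cmp q (suc (length P))
  ... | tri< (s≤s q≤len) _ _
    rewrite at-++ˡ P [ u ] (InBlock-positive q∈ℓ) q≤len | at-++ˡ P [ u ] (InBlock-positive p∈ℓ) (≤-trans (<⇒≤ p<q) q≤len)
    = dec ℓ p q p∈ℓ q∈ℓ p<q
  ... | tri> _ _ q>
    rewrite at-beyond (P ∷ʳ u) (subst (_< q) (sym (length-∷ʳ P u)) q>)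
    = at-positive p (∷ʳ⁺ pos 1≤u)
  ... | tri≈ _ refl _
    rewrite at-∷ʳ-last P u | at-++ˡ P [ u ] (InBlock-positive p∈ℓ) (≤-pred p<q)
    = ≤-trans (u≤last ℓ len∈ℓ q∈ℓ) (last≤p (m≤n⇒m<n∨m≡n (≤-pred p<q)))
    where
    len∈ℓ = InBlock-between p∈ℓ q∈ℓ (≤-pred p<q) (n≤1+n _)
    last≤p : p < length P ⊎ p ≡ length P → at P (length P) ≤ at P p
    last≤p (inj₁ p<len) = dec ℓ p (length P) p∈ℓ len∈ℓ p<len
    last≤p (inj₂ refl)  = ≤-refl

suc-maximum-addable : ∀ {P} → IsLattice P → Addable P (suc (maximum P))
suc-maximum-addable {P} lat a 1≤a a≤max = begin-strict
  count (suc (maximum P)) P  ≡⟨ count-beyond-maximum P ≤-refl ⟩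
  0                          <⟨ count-maximum P (≤-trans 1≤a (≤-pred a≤max)) ⟩
  count (maximum P) P        ≤⟨ count-antitone lat 1≤a (≤-pred a≤max) ⟩
  count a P                  ∎
  where open ≤-Reasoning

-- Descend from v to the first value whose count is strictly below that of its predecessor.
addable-between : ∀ {P x v} → IsLattice P → 1 ≤ x → x < v → count v P < count x P →
  ∃[ u ] x < u × u ≤ v × Addable P u
addable-between {P} {x} {suc v} lat 1≤x (s≤s x≤v) drop with count (suc v) P <? count v P
... | yes step = suc v , s≤s x≤v , ≤-refl ,
      λ a 1≤a a<u → <-≤-trans step (count-antitone lat 1≤a (≤-pred a<u))
... | no no-step with m≤n⇒m<n∨m≡n x≤v
...   | inj₂ refl = ⊥-elim (no-step drop)
...   | inj₁ x<v with addable-between lat 1≤x x<v (≤-<-trans (≮⇒≥ no-step) drop)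
...     | u , x<u , u≤v , addable = u , x<u , m≤n⇒m≤1+n u≤v , addable

module Minimal {δ ω̂} (minimal : IsMinimal δ ω̂) where

  length-ω̂ : length ω̂ ≡ sum δ
  length-ω̂ = proj₁ minimal

  admissible-prefix : ∀ k → k ≤ length ω̂ → Admissible δ (take k ω̂)
  admissible-prefix zero    _  = admissible-[] δ
  admissible-prefix (suc k) k< = proj₁ (proj₂ (proj₂ minimal) (suc k) (s≤s z≤n) k<)

  lattice-ω̂ : IsLattice ω̂
  lattice-ω̂ = subst IsLattice (take-all (length ω̂) ω̂ ≤-refl) (proj₁ (admissible-prefix (length ω̂) ≤-refl))

  -- Maximality of ω̂: every admissible one-step extension of a prefix is bounded by the actual next entry.
  addable-≤-next : ∀ k → suc k ≤ length ω̂ → ∀ u → 1 ≤ u → Addable (take k ω̂) u →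
    (∀ ℓ → InBlock δ ℓ k → InBlock δ ℓ (suc k) → u ≤ at ω̂ k) → u ≤ at ω̂ (suc k)
  addable-≤-next k k< u 1≤u addable u≤prev = ≮⇒≥ λ next<u →
    proj₂ (proj₂ (proj₂ minimal) (suc k) (s≤s z≤n) k<) u next<u
      ( lattice-∷ʳ (proj₁ P-admissible) 1≤u addable
      , deltaNonincreasing-∷ʳ (proj₂ P-admissible) (proj₁ (proj₁ P-admissible))
          (subst (_< sum δ) (sym length-P) (subst (suc k ≤_) length-ω̂ k<)) 1≤u
          (subst (λ m → ∀ ℓ → InBlock δ ℓ m → InBlock δ ℓ (suc m) → u ≤ at (take k ω̂) m) (sym length-P)
             (λ ℓ k∈ℓ k+1∈ℓ → subst (u ≤_) (sym (at-take ω̂ (InBlock-positive k∈ℓ) ≤-refl)) (u≤prev ℓ k∈ℓ k+1∈ℓ))))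
    where
    k≤ = ≤-trans (n≤1+n k) k<
    P-admissible = admissible-prefix k k≤
    length-P = length-take-≤ ω̂ k≤

  count-next-at-block-start : ∀ {k ℓ} → suc k ≤ length ω̂ → InBlock δ ℓ (suc k) → sum (take (ℓ ∸ 1) δ) ≡ k →
    count (at ω̂ (suc k)) (take k ω̂) ≡ 0
  count-next-at-block-start {k} {ℓ} k< k+1∈ℓ start≡k = count-beyond-maximum (take k ω̂)
    (addable-≤-next k k< _ (s≤s z≤n) (suc-maximum-addable (proj₁ (admissible-prefix k (≤-trans (n≤1+n k) k<))))
      λ ℓ' k∈ℓ' k+1∈ℓ' → ⊥-elim (<-irrefl start≡k (subst (λ ℓ → sum (take (ℓ ∸ 1) δ) < k) (InBlock-unique k+1∈ℓ' k+1∈ℓ) (proj₁ (proj₂ (proj₂ k∈ℓ'))))))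

  count-next-in-block : ∀ {k ℓ} → suc k ≤ length ω̂ → InBlock δ ℓ k → InBlock δ ℓ (suc k) →
    count (at ω̂ (suc k)) (take k ω̂) ≡ count (at ω̂ k) (take k ω̂)
  count-next-in-block {k} {ℓ} k< k∈ℓ k+1∈ℓ = ≤-antisym (≮⇒≥ no-drop) (count-antitone lat-P 1≤x x≤v)
    where
    P = take k ω̂
    x = at ω̂ (suc k)
    v = at ω̂ k
    lat-P = proj₁ (admissible-prefix k (≤-trans (n≤1+n k) k<))
    1≤x = at-positive (suc k) (proj₁ lattice-ω̂)
    x≤v : x ≤ v
    x≤v = subst₂ _≤_ (at-take ω̂ (s≤s z≤n) ≤-refl) (at-take ω̂ (InBlock-positive k∈ℓ) (n≤1+n k))
            (proj₂ (proj₂ (admissible-prefix (suc k) k<)) ℓ k (suc k) k∈ℓ k+1∈ℓ ≤-refl)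
    no-drop : ¬ count v P < count x P
    no-drop drop with m≤n⇒m<n∨m≡n x≤v
    ... | inj₂ x≡v = <-irrefl (cong (λ y → count y P) (sym x≡v)) drop
    ... | inj₁ x<v with addable-between lat-P 1≤x x<v drop
    ...   | u , x<u , u≤v , addable = <⇒≱ x<u (addable-≤-next k k< u (≤-trans 1≤x (<⇒≤ x<u)) addable (λ _ _ _ → u≤v))

  runMult-in-block : ∀ {i ℓ} → i ≤ length ω̂ → InBlock δ ℓ i → count (at ω̂ i) (take i ω̂) ≡ i ∸ sum (take (ℓ ∸ 1) δ)
  runMult-in-block {suc k} {ℓ} k< k+1∈ℓ@(1≤ℓ , ℓ≤r , start<k+1 , k+1≤end) = begin
    count x (take (suc k) ω̂)     ≡⟨ cong (count x) (take-suc-∷ʳ k ω̂ k<) ⟩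
    count x (take k ω̂ ∷ʳ x)      ≡⟨ count-∷ʳ-≡ x (take k ω̂) ⟩
    suc (count x (take k ω̂))     ≡⟨ cong suc (previous (m≤n⇒m<n∨m≡n (≤-pred start<k+1))) ⟩
    suc (k ∸ start)              ≡⟨ sym (+-∸-assoc 1 (≤-pred start<k+1)) ⟩
    suc k ∸ start                ∎
    where
    open ≡-Reasoning
    x = at ω̂ (suc k)
    start = sum (take (ℓ ∸ 1) δ)
    previous : start < k ⊎ start ≡ k → count x (take k ω̂) ≡ k ∸ start
    previous (inj₁ start<k) = trans (count-next-in-block k< k∈ℓ k+1∈ℓ) (runMult-in-block (≤-trans (n≤1+n k) k<) k∈ℓ)
      where k∈ℓ = 1≤ℓ , ℓ≤r , start<k , ≤-trans (n≤1+n k) k+1≤end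
    previous (inj₂ start≡k) = trans (count-next-at-block-start k< k+1∈ℓ start≡k) (sym (subst (λ s → k ∸ s ≡ 0) (sym start≡k) (n∸n≡0 k)))

  runMult-minimal : runMult ω̂ ≡ concatMap oneTo δ
  runMult-minimal = ≡-by-at _ _ (trans (length-runMult ω̂) (trans length-ω̂ (sym (length-concat-oneTo δ)))) same
    where
    same : ∀ i → 1 ≤ i → i ≤ length (runMult ω̂) → at (runMult ω̂) i ≡ at (concatMap oneTo δ) i
    same i 1≤i i≤ with InBlock-exists δ 1≤i (subst (i ≤_) (trans (length-runMult ω̂) length-ω̂) i≤)
    ... | ℓ , i∈ℓ = trans (at-runMult ω̂ 1≤i i≤len) (trans (runMult-in-block i≤len i∈ℓ) (sym (at-concat-oneTo δ i∈ℓ)))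
      where i≤len = subst (i ≤_) (length-runMult ω̂) i≤

  content-minimal : ∀ i → 1 ≤ i → content ω̂ i ≡ part (srt δ) i
  content-minimal i 1≤i = trans (content≡part-contentList ω̂ 1≤i)
    (part-unique (contentList-nonIncreasing lattice-ω̂) (srt-nonIncreasing δ) same-conj i 1≤i)
    where
    same-conj : ∀ s → 1 ≤ s → conj (contentList ω̂) s ≡ conj (srt δ) s
    same-conj s 1≤s = begin
      conj (contentList ω̂) s       ≡⟨ conj-content≡count-runMult (proj₁ lattice-ω̂) s 1≤s ⟩
      count s (runMult ω̂)          ≡⟨ cong (count s) runMult-minimal ⟩
      count s (concatMap oneTo δ)  ≡⟨ count-concat-oneTo δ 1≤s ⟩
      conj δ s                     ≡⟨ sym (conj-srt δ s) ⟩
      conj (srt δ) s               ∎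
      where open ≡-Reasoning

lemma6p7 : (n : ℕ) (δ : List ℕ) → IsComposition n δ →
    (ω : List ℕ) → InOmega δ ω →
    (ω̂ : List ℕ) → IsMinimal δ ω̂ →
    (∀ i → 1 ≤ i → conj (contentList ω) i ≡ count i (runMult ω)) ×
    ((∀ a b → 1 ≤ a → b ≤ n →
        (∀ i j → a ≤ i → i < j → j ≤ b → at ω j ≤ at ω i) →
        ∀ i j → a ≤ i → i < j → j ≤ b → at (runMult ω) i < at (runMult ω) j) ×
     (∀ ℓ i j → InBlock δ ℓ i → InBlock δ ℓ j → i < j → at (runMult ω) i < at (runMult ω) j)) ×
    runMult ω̂ ≡ concatMap oneTo δ ×
    (∀ i → 1 ≤ i → content ω̂ i ≡ part (srt δ) i)
lemma6p7 n δ (_ , sum≡n) ω (length-ω , lattice-ω , _ , ω-δ-nonincreasing) ω̂ minimal =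
  conj-content≡count-runMult (proj₁ lattice-ω) ,
  ( (λ a b 1≤a b≤n nonincreasing i j a≤i i<j j≤b →
       runMult-increasing lattice-ω (≤-trans 1≤a a≤i) i<j (≤-trans j≤b (≤-trans b≤n (≤-reflexive n≡length))) (nonincreasing i j a≤i i<j j≤b))
  , (λ ℓ i j i∈ℓ j∈ℓ i<j →
       runMult-increasing lattice-ω (InBlock-positive i∈ℓ) i<j (≤-trans (InBlock-≤-sum j∈ℓ) (≤-reflexive (sym length-ω)))
         (ω-δ-nonincreasing ℓ i j i∈ℓ j∈ℓ i<j)) ) ,
  runMult-minimal ,
  content-minimal
  where
  open Minimal minimal
  n≡length = trans (sym sum≡n) (sym length-ω)
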